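{- Let $q$ be a power of an odd prime with $q\equiv 7\pmod 8$, and $F=F_{2,\frac13}(x)=x^2\big(1+\frac13\eta(x)\big)$ over $\mathbb{F}_q$. Then $\delta_F(1,\frac43)=2$ if $q\equiv 7\pmod{24}$ and $\delta_F(1,\frac43)=1$ if $q\equiv 23\pmod{24}$.
   Context: $\eta$ is the quadratic character of $\mathbb{F}_q$ ($\eta(0)=0$, $\eta=1$ on nonzero squares, $-1$ on non-squares). $\delta_F(1,b)=\#\{x\in\mathbb{F}_q: F(x+1)-F(x)=b\}$. -}

module Defs where

open import Level using (0ℓ)
open import Data.Nat as ℕ using (ℕ; zero; suc)
open import Data.Integer as ℤ using (ℤ; +_; -[1+_])
open import Data.Fin using (Fin)
open import Data.List using (List; map; filter; length; allFin)
open import Data.Bool.ListAction using (any)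
open import Data.Product using (Σ; _×_; _,_)
open import Data.Bool using (Bool; true; false; if_then_else_)
open import Algebra.Core using (Op₁; Op₂)
open import Algebra.Structures using (IsCommutativeRing)
open import Function.Bundles using (_↔_; Inverse)
open import Relation.Binary.PropositionalEquality using (_≡_; _≢_)
open import Relation.Binary.Definitions using (DecidableEquality)
open import Relation.Nullary using (does)
open import Data.Nat.Primality using (Prime)

-- A finite field with exactly q elements (equality is propositional).
-- The inverse is a total operation; only its behaviour on nonzero
-- elements is specified.
record FiniteField (q : ℕ) : Set₁ where
  infixl 6 _+_ _-_
  infixl 7 _*_
  field
    Carrier : Set
    _+_ _*_ : Op₂ Carrier
    -_      : Op₁ Carrier
    0# 1#   : Carrier
    _⁻¹     : Op₁ Carrier
    isCommutativeRing : IsCommutativeRing _≡_ _+_ _*_ -_ 0# 1#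
    0≢1     : 0# ≢ 1#
    inverseʳ : ∀ x → x ≢ 0# → x * (x ⁻¹) ≡ 1#
    enum    : Fin q ↔ Carrier
    _≟_     : DecidableEquality Carrier

  _-_ : Op₂ Carrier
  x - y = x + (- y)

  elements : List Carrier
  elements = map (Inverse.to enum) (allFin q)

  fromℕ : ℕ → Carrier
  fromℕ zero    = 0#
  fromℕ (suc n) = 1# + fromℕ n

  fromℤ : ℤ → Carrier
  fromℤ (+ n)     = fromℕ n
  fromℤ -[1+ n ]  = - fromℕ (suc n)

  isSquare : Carrier → Bool
  isSquare x = any (λ y → does ((y * y) ≟ x)) elements

  η : Carrier → ℤ
  η x with does (x ≟ 0#)
  ... | true  = + 0
  ... | false = if isSquare x then + 1 else -[1+ 0 ]

  δ : (Carrier → Carrier) → Carrier → Carrier → ℕ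
  δ F a b = length (filter (λ x → (F (x + a) - F x) ≟ b) elements)

  F₂,⅓ : Carrier → Carrier
  F₂,⅓ x = (x * x) * (1# + (fromℕ 3 ⁻¹) * fromℤ (η x))

IsOddPrimePower : ℕ → Set
IsOddPrimePower q = Σ ℕ λ p → Σ ℕ λ k → Prime p × (p ℕ.% 2 ≡ 1) × (q ≡ p ℕ.^ suc k)

-- Multiplying by 3, F(x+1) - F(x) = 4/3 becomes (x+1)²(3 + η(x+1)) - x²(3 + η(x)) = 4, and the nine
-- possible values of (η(x), η(x+1)) leave exactly x = 0 and, when -3 is a square, x = -4.
-- The square classes this needs (-1 and -4 non-squares, 2 a square, -3 a square iff q ≡ 1 mod 3) all
-- come from counting: a group of order n acting freely on a finite set of size s forces n ∣ s.
-- The groups are the translations by 1, multiplication by a root of unity on the units,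
-- t ↦ 1/(1-t) of order 3 on 𝔽_q ∖ {0,1}, and the dihedral group of order 8 generated by
-- t ↦ (1+t)/(1-t) and t ↦ -t on 𝔽_q ∖ {0,±1}; each action is free exactly when the square root in
-- question does not exist. Only q mod 24 enters.

module Submission where

open import Defs
open import Level using (0ℓ)
open import Data.Nat as ℕ using (ℕ; zero; suc; _<_; s≤s; NonZero)
import Data.Nat.Properties as ℕP
open import Data.Nat.DivMod using (_%_; [m+kn]%n≡m%n; m∣n⇒o%n%m≡o%m)
open import Data.Nat.Divisibility using (_∣_; divides)
open import Data.Nat.GeneralisedArithmetic using (fold)
open import Data.Integer as ℤ using (ℤ; -[1+_]; _⊖_; _◃_; sign; ∣_∣)
import Data.Integer.Properties as ℤP
open import Data.Sign as Sign using (Sign)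
open import Data.Sum using (_⊎_; inj₁; inj₂; [_,_]; reduce; fromInj₂; map₂)
open import Data.Product using (∃-syntax; _×_; _,_; proj₁; proj₂)
open import Data.Bool using (T; true; false)
open import Data.Bool.Properties using (T-≡)
open import Data.Unit using (tt)
open import Data.Empty using (⊥-elim)
open import Data.Maybe using (Maybe; just; nothing)
open import Data.List using (List; []; _∷_; length; filter; allFin)
open import Data.List.Properties using (length-map; length-tabulate)
open import Data.List.Membership.Propositional using (_∈_; find; lose)
open import Data.List.Membership.Propositional.Properties using (∈-filter⁺; ∈-filter⁻; ∈-map⁺; ∈-allFin)
import Data.List.Membership.DecPropositional as DecMembership
open import Data.List.Relation.Unary.All as All using (All; []; _∷_)
open import Data.List.Relation.Unary.All.Properties using (¬Any⇒All¬; All¬⇒¬Any)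
open import Data.List.Relation.Unary.AllPairs using ([]; _∷_)
open import Data.List.Relation.Unary.Any as Any using (here; there)
open import Data.List.Relation.Unary.Any.Properties using (any⁺; any⁻)
open import Data.List.Relation.Unary.Unique.Propositional using (Unique)
import Data.List.Relation.Unary.Unique.Propositional.Properties as Unique
open import Function.Bundles using (Inverse; Equivalence; _⇔_; mk⇔)
open import Algebra.Bundles using (CommutativeRing)
import Algebra.Solver.Ring.AlmostCommutativeRing as ACR
open import Relation.Nullary using (¬_; Dec; yes; no; does)
open import Relation.Nullary.Decidable using (¬?)
open import Relation.Nullary.Negation using (contradiction)
open import Relation.Binary.PropositionalEquality
  using (_≡_; _≢_; refl; sym; trans; cong; cong₂; subst; subst₂; module ≡-Reasoning)

module OrbitCounting where
  open import Data.Nat using (_+_; _*_; _∸_; _≤_; z≤n)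
  open import Data.Nat.Properties
    using (≤-refl; ≤-trans; ≤-pred; ≤-<-trans; <⇒≤; <-cmp; +-comm; +-suc; *-suc; +-monoˡ-≤;
           m∸n+n≡m; m∸n≤m; m<n⇒0<n∸m)
  open import Data.Nat.DivMod using (_/_; m≡m%n+[m/n]*n; m%n<n)
  open import Data.Nat.Divisibility using (_∣0; ∣m∣n⇒∣m+n; ∣-refl)
  open import Data.Nat.GeneralisedArithmetic using (fold-+)
  open import Data.Fin as Fin using (Fin; toℕ; fromℕ<)
  open import Data.Fin.Properties using (toℕ<n; toℕ-fromℕ<; toℕ-injective; any?)
  open import Data.List using (map)
  open import Data.List.Membership.Propositional.Properties using (∈-map⁻)
  open import Data.List.Membership.Propositional.Properties.WithK using (unique∧set⇒bag)
  open import Data.List.Relation.Binary.BagAndSetEquality using (∼bag⇒↭)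
  open import Data.List.Relation.Binary.Permutation.Propositional.Properties using (↭-length)
  open import Relation.Nullary.Decidable using (_⊎-dec_)
  open import Relation.Unary using (Pred; Decidable)
  open import Relation.Unary.Properties using (∁?)
  open import Relation.Binary using (Rel)
  import Relation.Binary as B
  open import Relation.Binary.Definitions using (DecidableEquality; tri<; tri≈; tri>)

  module _ {A : Set} where

    length-filter+length-filter-∁ : ∀ {P : Pred A 0ℓ} (P? : Decidable P) xs →
      length (filter P? xs) + length (filter (∁? P?) xs) ≡ length xs
    length-filter+length-filter-∁ P? [] = refl
    length-filter+length-filter-∁ P? (x ∷ xs) with P? x
    ... | yes _ = cong suc (length-filter+length-filter-∁ P? xs)
    ... | no  _ = trans (+-suc _ _) (cong suc (length-filter+length-filter-∁ P? xs))

    unique-⇔⇒length≡ : ∀ {xs ys : List A} → Unique xs → Unique ys →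
      (∀ {z} → z ∈ xs ⇔ z ∈ ys) → length xs ≡ length ys
    unique-⇔⇒length≡ xs! ys! xs⇔ys = ↭-length (∼bag⇒↭ (unique∧set⇒bag xs! ys! xs⇔ys))

    ∈⇒0<length : ∀ {x : A} {xs} → x ∈ xs → 0 < length xs
    ∈⇒0<length {xs = _ ∷ _} _ = s≤s z≤n

    module _ {R : Rel A 0ℓ} (R? : B.Decidable R) where

      record IsUniformPartition (n : ℕ) (S : List A) : Set where
        field
          unique     : Unique S
          reflexive  : ∀ {x} → x ∈ S → R x x
          symmetric  : ∀ {x y} → x ∈ S → y ∈ S → R x y → R y x
          transitive : ∀ {x y z} → x ∈ S → y ∈ S → z ∈ S → R x y → R y z → R x z
          class-size : ∀ {x} → x ∈ S → length (filter (R? x) S) ≡ n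

      module _ {n S} (P : IsUniformPartition n S) {x} (x∈S : x ∈ S) where
        open IsUniformPartition P

        private
          rest : List A
          rest = filter (∁? (R? x)) S

          rest⊆S : ∀ {y} → y ∈ rest → y ∈ S
          rest⊆S y∈ = proj₁ (∈-filter⁻ (∁? (R? x)) {xs = S} y∈)

        length≡class+rest : length S ≡ n + length rest
        length≡class+rest = begin
          length S                                        ≡⟨ length-filter+length-filter-∁ (R? x) S ⟨
          length (filter (R? x) S) + length rest          ≡⟨ cong (_+ length rest) (class-size x∈S) ⟩
          n + length rest                                 ∎
          where open ≡-Reasoning

        0<n : 0 < n
        0<n = subst (0 <_) (class-size x∈S) (∈⇒0<length (∈-filter⁺ (R? x) x∈S (reflexive x∈S)))

        removeClass : IsUniformPartition n rest
        removeClass = record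
          { unique     = Unique.filter⁺ (∁? (R? x)) unique
          ; reflexive  = λ y∈ → reflexive (rest⊆S y∈)
          ; symmetric  = λ y∈ z∈ → symmetric (rest⊆S y∈) (rest⊆S z∈)
          ; transitive = λ y∈ z∈ w∈ → transitive (rest⊆S y∈) (rest⊆S z∈) (rest⊆S w∈)
          ; class-size = λ y∈ → trans (same-class y∈) (class-size (rest⊆S y∈))
          }
          where
          same-class : ∀ {y} → y ∈ rest → length (filter (R? y) rest) ≡ length (filter (R? y) S)
          same-class {y} y∈ = unique-⇔⇒length≡
            (Unique.filter⁺ (R? y) (Unique.filter⁺ (∁? (R? x)) unique))
            (Unique.filter⁺ (R? y) unique)
            (mk⇔ (λ z∈ → let z∈rest , Ryz = ∈-filter⁻ (R? y) z∈ in
                         ∈-filter⁺ (R? y) (rest⊆S z∈rest) Ryz)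
                 (λ z∈ → let z∈S , Ryz = ∈-filter⁻ (R? y) z∈ in
                         ∈-filter⁺ (R? y) (∈-filter⁺ (∁? (R? x)) z∈S (¬Rxz z∈S Ryz)) Ryz))
            where
            ¬Rxz : ∀ {z} → z ∈ S → R y z → ¬ R x z
            ¬Rxz z∈S Ryz Rxz = proj₂ (∈-filter⁻ (∁? (R? x)) {xs = S} y∈)
              (transitive x∈S z∈S (rest⊆S y∈) Rxz (symmetric (rest⊆S y∈) z∈S Ryz))

      class-size∣length : ∀ {n S} → IsUniformPartition n S → n ∣ length S
      class-size∣length {n} {S} = go (length S) ≤-refl
        where
        go : ∀ k {S} → length S ≤ k → IsUniformPartition n S → n ∣ length S
        go _       {[]}        _  _ = n ∣0
        go (suc k) {S@(_ ∷ _)} ≤k P =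
          subst (n ∣_) (sym (length≡class+rest P (here refl)))
            (∣m∣n⇒∣m+n ∣-refl (go k rest≤k (removeClass P (here refl))))
          where
          rest≤k = ≤-pred (≤-trans (+-monoˡ-≤ _ (0<n P (here refl)))
                                   (subst (_≤ suc k) (length≡class+rest P (here refl)) ≤k))

    module _ {R : Rel A 0ℓ} (R? : B.Decidable R) {n S} (P : IsUniformPartition R? n S)
             (s : A → A)
             (s-closed    : ∀ {x} → x ∈ S → s x ∈ S)
             (s-involutive : ∀ {x} → x ∈ S → s (s x) ≡ x)
             (s-respects  : ∀ {x y} → x ∈ S → R x y → R (s x) (s y))
             (s-separates : ∀ {x} → x ∈ S → ¬ R x (s x)) where
      open IsUniformPartition P

      private
        D : Rel A 0ℓ
        D x y = R x y ⊎ R (s x) y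

        D? : B.Decidable D
        D? x y = R? x y ⊎-dec R? (s x) y

        R-s⁻¹ : ∀ {x y} → x ∈ S → R (s x) y → R x (s y)
        R-s⁻¹ x∈S r = subst (λ u → R u _) (s-involutive x∈S) (s-respects (s-closed x∈S) r)

      doubledPartition : IsUniformPartition D? (n + n) S
      doubledPartition = record
        { unique     = unique
        ; reflexive  = λ x∈S → inj₁ (reflexive x∈S)
        ; symmetric  = D-sym
        ; transitive = D-trans
        ; class-size = D-class-size
        }
        where
        D-sym : ∀ {x y} → x ∈ S → y ∈ S → D x y → D y x
        D-sym x∈S y∈S (inj₁ r) = inj₁ (symmetric x∈S y∈S r)
        D-sym x∈S y∈S (inj₂ r) = inj₂ (symmetric x∈S (s-closed y∈S) (R-s⁻¹ x∈S r))

        D-trans : ∀ {x y z} → x ∈ S → y ∈ S → z ∈ S → D x y → D y z → D x z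
        D-trans x∈S y∈S z∈S (inj₁ r₁) (inj₁ r₂) = inj₁ (transitive x∈S y∈S z∈S r₁ r₂)
        D-trans x∈S y∈S z∈S (inj₁ r₁) (inj₂ r₂) =
          inj₂ (transitive (s-closed x∈S) (s-closed y∈S) z∈S (s-respects x∈S r₁) r₂)
        D-trans x∈S y∈S z∈S (inj₂ r₁) (inj₁ r₂) = inj₂ (transitive (s-closed x∈S) y∈S z∈S r₁ r₂)
        D-trans x∈S y∈S z∈S (inj₂ r₁) (inj₂ r₂) =
          inj₁ (transitive x∈S (s-closed y∈S) z∈S (R-s⁻¹ x∈S r₁) r₂)

        D-class-size : ∀ {x} → x ∈ S → length (filter (D? x) S) ≡ n + n
        D-class-size {x} x∈S = begin
          length Dx                                                  ≡⟨ length-filter+length-filter-∁ (R? x) Dx ⟨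
          length (filter (R? x) Dx) + length (filter (∁? (R? x)) Dx) ≡⟨ cong₂ _+_ Rx-part sRx-part ⟩
          length (filter (R? x) S) + length (filter (R? (s x)) S)
            ≡⟨ cong₂ _+_ (class-size x∈S) (class-size (s-closed x∈S)) ⟩
          n + n                                                      ∎
          where
          open ≡-Reasoning
          Dx = filter (D? x) S
          Dx! = Unique.filter⁺ (D? x) unique
          Rx-part : length (filter (R? x) Dx) ≡ length (filter (R? x) S)
          Rx-part = unique-⇔⇒length≡ (Unique.filter⁺ (R? x) Dx!) (Unique.filter⁺ (R? x) unique) (mk⇔
            (λ z∈ → let z∈Dx , r = ∈-filter⁻ (R? x) {xs = Dx} z∈ in
                    ∈-filter⁺ (R? x) (proj₁ (∈-filter⁻ (D? x) {xs = S} z∈Dx)) r)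
            (λ z∈ → let z∈S , r = ∈-filter⁻ (R? x) {xs = S} z∈ in
                    ∈-filter⁺ (R? x) (∈-filter⁺ (D? x) z∈S (inj₁ r)) r))
          sRx-part : length (filter (∁? (R? x)) Dx) ≡ length (filter (R? (s x)) S)
          sRx-part = unique-⇔⇒length≡ (Unique.filter⁺ (∁? (R? x)) Dx!) (Unique.filter⁺ (R? (s x)) unique) (mk⇔
            (λ z∈ → let z∈Dx , ¬r = ∈-filter⁻ (∁? (R? x)) {xs = Dx} z∈
                        z∈S , d = ∈-filter⁻ (D? x) {xs = S} z∈Dx in
                    ∈-filter⁺ (R? (s x)) z∈S (fromInj₂ (λ r → ⊥-elim (¬r r)) d))
            (λ z∈ → let z∈S , r = ∈-filter⁻ (R? (s x)) {xs = S} z∈ in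
                    ∈-filter⁺ (∁? (R? x)) (∈-filter⁺ (D? x) z∈S (inj₂ r))
                      (λ r′ → s-separates x∈S
                        (transitive x∈S z∈S (s-closed x∈S) r′ (symmetric (s-closed x∈S) z∈S r)))))

    SameOrbit : (A → A) → ℕ → Rel A 0ℓ
    SameOrbit g n x y = ∃[ i ] fold x g (toℕ {n} i) ≡ y

    record IsFreeCyclicAction (g : A → A) (n : ℕ) (S : List A) : Set where
      field
        closed : ∀ {x} → x ∈ S → g x ∈ S
        period : ∀ {x} → x ∈ S → fold x g n ≡ x
        free   : ∀ {x} → x ∈ S → ∀ k → 0 < k → k < n → fold x g k ≢ x

    module Orbits {g m S} (C : IsFreeCyclicAction g (suc m) S) where
      open IsFreeCyclicAction C
      private
        n = suc m
        _~_ = SameOrbit g n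

      fold-closed : ∀ {x} → x ∈ S → ∀ k → fold x g k ∈ S
      fold-closed x∈S zero    = x∈S
      fold-closed x∈S (suc k) = closed (fold-closed x∈S k)

      fold-*period : ∀ {x} → x ∈ S → ∀ j → fold x g (j * n) ≡ x
      fold-*period x∈S zero    = refl
      fold-*period {x} x∈S (suc j) = begin
        fold x g (n + j * n)          ≡⟨ fold-+ x g n ⟩
        fold (fold x g (j * n)) g n   ≡⟨ cong (λ y → fold y g n) (fold-*period x∈S j) ⟩
        fold x g n                    ≡⟨ period x∈S ⟩
        x                             ∎
        where open ≡-Reasoning

      fold-% : ∀ {x} → x ∈ S → ∀ k → fold x g (k % n) ≡ fold x g k
      fold-% {x} x∈S k = begin
        fold x g (k % n)                           ≡⟨ cong (λ y → fold y g (k % n)) (fold-*period x∈S (k / n)) ⟨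
        fold (fold x g ((k / n) * n)) g (k % n)    ≡⟨ fold-+ x g (k % n) ⟨
        fold x g (k % n + (k / n) * n)             ≡⟨ cong (fold x g) (m≡m%n+[m/n]*n k n) ⟨
        fold x g k                                 ∎
        where open ≡-Reasoning

      fold⇒~ : ∀ {x} → x ∈ S → ∀ k → x ~ fold x g k
      fold⇒~ {x} x∈S k = fromℕ< (m%n<n k n) , trans (cong (fold x g) (toℕ-fromℕ< (m%n<n k n))) (fold-% x∈S k)

      ~-sym : ∀ {x y} → x ∈ S → x ~ y → y ~ x
      ~-sym {x} x∈S (i , refl) = subst (fold x g (toℕ i) ~_) back (fold⇒~ (fold-closed x∈S (toℕ i)) (toℕ i * m))
        where
        open ≡-Reasoning
        back : fold (fold x g (toℕ i)) g (toℕ i * m) ≡ x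
        back = begin
          fold (fold x g (toℕ i)) g (toℕ i * m)   ≡⟨ fold-+ x g (toℕ i * m) ⟨
          fold x g (toℕ i * m + toℕ i)
            ≡⟨ cong (fold x g) (trans (+-comm _ (toℕ i)) (sym (*-suc (toℕ i) m))) ⟩
          fold x g (toℕ i * n)                    ≡⟨ fold-*period x∈S (toℕ i) ⟩
          x                                       ∎

      ~-trans : ∀ {x y z} → x ∈ S → x ~ y → y ~ z → x ~ z
      ~-trans {x} x∈S (i , refl) (j , refl) =
        subst (x ~_) (fold-+ x g (toℕ j)) (fold⇒~ x∈S (toℕ j + toℕ i))

      orbit : A → List A
      orbit x = map (λ i → fold x g (toℕ i)) (allFin n)

      orbit-unique : ∀ {x} → x ∈ S → Unique (orbit x)
      orbit-unique {x} x∈S = Unique.map⁺ injective (Unique.allFin⁺ n)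
        where
        distinct : ∀ {a b} → a < b → b < n → fold x g a ≢ fold x g b
        distinct {a} {b} a<b b<n eq = free (fold-closed x∈S a) (b ∸ a) (m<n⇒0<n∸m a<b)
          (≤-<-trans (m∸n≤m b a) b<n)
          (trans (sym (fold-+ x g (b ∸ a))) (trans (cong (fold x g) (m∸n+n≡m (<⇒≤ a<b))) (sym eq)))
        injective : ∀ {i j : Fin n} → fold x g (toℕ i) ≡ fold x g (toℕ j) → i ≡ j
        injective {i} {j} eq with <-cmp (toℕ i) (toℕ j)
        ... | tri< i<j _ _ = ⊥-elim (distinct i<j (toℕ<n j) eq)
        ... | tri≈ _ i≡j _ = toℕ-injective i≡j
        ... | tri> _ _ j<i = ⊥-elim (distinct j<i (toℕ<n i) (sym eq))


    record IsFreeDihedralAction (g s : A → A) (n : ℕ) (S : List A) : Set where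
      field
        rotation     : IsFreeCyclicAction g n S
        s-closed     : ∀ {x} → x ∈ S → s x ∈ S
        s-involutive : ∀ {x} → x ∈ S → s (s x) ≡ x
        s-inverts    : ∀ {x} → x ∈ S → g (s (g x)) ≡ s x
        s-free       : ∀ {x} → x ∈ S → ∀ k → k < n → fold x g k ≢ s x


    module _ (_≟_ : DecidableEquality A) where

      sameOrbit? : ∀ g n → B.Decidable (SameOrbit g n)
      sameOrbit? g n x y = any? (λ i → fold x g (toℕ i) ≟ y)

      orbitPartition : ∀ {g m S} → Unique S → (C : IsFreeCyclicAction g (suc m) S) →
                         IsUniformPartition (sameOrbit? g (suc m)) (suc m) S
      orbitPartition {g} {m} {S} S! C = record
        { unique     = S!
        ; reflexive  = λ _ → Fin.zero , refl
        ; symmetric  = λ x∈S _ → ~-sym x∈S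
        ; transitive = λ x∈S _ _ → ~-trans x∈S
        ; class-size = class-size
        }
        where
        open Orbits C
        n = suc m
        class-size : ∀ {x} → x ∈ S → length (filter (sameOrbit? g n x) S) ≡ n
        class-size {x} x∈S =
          trans (unique-⇔⇒length≡ (Unique.filter⁺ (sameOrbit? g n x) S!) (orbit-unique x∈S) (mk⇔ to from))
                (trans (length-map _ (allFin n)) (length-tabulate {n = n} (λ i → i)))
          where
          to : ∀ {z} → z ∈ filter (sameOrbit? g n x) S → z ∈ orbit x
          to z∈ with ∈-filter⁻ (sameOrbit? g n x) {xs = S} z∈
          ... | _ , (i , refl) = ∈-map⁺ _ (∈-allFin i)
          from : ∀ {z} → z ∈ orbit x → z ∈ filter (sameOrbit? g n x) S
          from z∈ with ∈-map⁻ (λ i → fold x g (toℕ i)) {xs = allFin n} z∈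
          ... | i , _ , refl = ∈-filter⁺ (sameOrbit? g n x) (fold-closed x∈S (toℕ i)) (i , refl)

      free-cyclic⇒n∣length : ∀ {g m S} → Unique S → IsFreeCyclicAction g (suc m) S → suc m ∣ length S
      free-cyclic⇒n∣length S! C = class-size∣length _ (orbitPartition S! C)

      free-dihedral⇒2n∣length : ∀ {g s m S} → Unique S → IsFreeDihedralAction g s (suc m) S →
                       suc m + suc m ∣ length S
      free-dihedral⇒2n∣length {g} {s} {m} {S} S! Dih =
        class-size∣length _ (doubledPartition (sameOrbit? g n) (orbitPartition S! rotation)
          s s-closed s-involutive s-respects s-separates)
        where
        open IsFreeDihedralAction Dih
        open IsFreeCyclicAction rotation
        open Orbits using (fold-closed; fold⇒~)
        n = suc m

        s∘g : ∀ {x} → x ∈ S → s (g x) ≡ fold (s x) g m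
        s∘g {x} x∈S = begin
          s (g x)                  ≡⟨ period (s-closed (closed x∈S)) ⟨
          fold (s (g x)) g (1 + m) ≡⟨ cong (fold (s (g x)) g) (+-comm 1 m) ⟩
          fold (s (g x)) g (m + 1) ≡⟨ fold-+ (s (g x)) g m ⟩
          fold (g (s (g x))) g m   ≡⟨ cong (λ y → fold y g m) (s-inverts x∈S) ⟩
          fold (s x) g m           ∎
          where open ≡-Reasoning

        s∘fold : ∀ {x} → x ∈ S → ∀ k → s (fold x g k) ≡ fold (s x) g (k * m)
        s∘fold x∈S zero    = refl
        s∘fold {x} x∈S (suc k) = begin
          s (g (fold x g k))                ≡⟨ s∘g (fold-closed rotation x∈S k) ⟩
          fold (s (fold x g k)) g m         ≡⟨ cong (λ y → fold y g m) (s∘fold x∈S k) ⟩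
          fold (fold (s x) g (k * m)) g m   ≡⟨ fold-+ (s x) g m ⟨
          fold (s x) g (m + k * m)          ∎
          where open ≡-Reasoning

        s-respects : ∀ {x y} → x ∈ S → SameOrbit g n x y → SameOrbit g n (s x) (s y)
        s-respects {x} x∈S (i , refl) =
          subst (SameOrbit g n (s x)) (sym (s∘fold x∈S (toℕ i))) (fold⇒~ rotation (s-closed x∈S) (toℕ i * m))

        s-separates : ∀ {x} → x ∈ S → ¬ SameOrbit g n x (s x)
        s-separates x∈S (i , eq) = s-free x∈S (toℕ i) (toℕ<n i) eq

open OrbitCounting

module FieldProperties {q : ℕ} (K : FiniteField q) where
  open FiniteField K

  commutativeRing : CommutativeRing 0ℓ 0ℓ
  commutativeRing = record { isCommutativeRing = isCommutativeRing }

  open CommutativeRing commutativeRing public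
    using (+-assoc; +-comm; *-assoc; *-comm; +-identityˡ; +-identityʳ; *-identityˡ; *-identityʳ;
           -‿inverseˡ; zeroˡ; zeroʳ)
  open import Algebra.Properties.Ring (CommutativeRing.ring commutativeRing) public
    using (-‿involutive; -0#≈0#; -‿+-comm; -1*x≈-x; x∙y⁻¹≈ε⇒x≈y; x≈y⇒x∙y⁻¹≈ε; +-cancelʳ)
  open import Algebra.Properties.Semiring.Mult (CommutativeRing.semiring commutativeRing)
    using (×-homo-+; ×1-homo-*) renaming (_×_ to _·_)
  open import Algebra.Properties.CommutativeSemigroup (CommutativeRing.*-commutativeSemigroup commutativeRing)
    using (interchange)
  open ≡-Reasoning

  fromℕ≗·1 : ∀ n → fromℕ n ≡ n · 1#
  fromℕ≗·1 zero    = refl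
  fromℕ≗·1 (suc n) = cong (1# +_) (fromℕ≗·1 n)

  fromℕ-+ : ∀ m n → fromℕ (m ℕ.+ n) ≡ fromℕ m + fromℕ n
  fromℕ-+ m n = begin
    fromℕ (m ℕ.+ n)       ≡⟨ fromℕ≗·1 (m ℕ.+ n) ⟩
    (m ℕ.+ n) · 1#        ≡⟨ ×-homo-+ 1# m n ⟩
    m · 1# + n · 1#       ≡⟨ cong₂ _+_ (fromℕ≗·1 m) (fromℕ≗·1 n) ⟨
    fromℕ m + fromℕ n     ∎

  fromℕ-* : ∀ m n → fromℕ (m ℕ.* n) ≡ fromℕ m * fromℕ n
  fromℕ-* m n = begin
    fromℕ (m ℕ.* n)       ≡⟨ fromℕ≗·1 (m ℕ.* n) ⟩
    (m ℕ.* n) · 1#        ≡⟨ ×1-homo-* m n ⟩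
    m · 1# * (n · 1#)     ≡⟨ cong₂ _*_ (fromℕ≗·1 m) (fromℕ≗·1 n) ⟨
    fromℕ m * fromℕ n     ∎

  fromℕ-∸ : ∀ {m n} → n ℕ.≤ m → fromℕ (m ℕ.∸ n) ≡ fromℕ m - fromℕ n
  fromℕ-∸ {m} {n} n≤m = +-cancelʳ (fromℕ n) _ _ (begin
    fromℕ (m ℕ.∸ n) + fromℕ n       ≡⟨ fromℕ-+ (m ℕ.∸ n) n ⟨
    fromℕ (m ℕ.∸ n ℕ.+ n)           ≡⟨ cong fromℕ (ℕP.m∸n+n≡m n≤m) ⟩
    fromℕ m                         ≡⟨ +-identityʳ (fromℕ m) ⟨
    fromℕ m + 0#                    ≡⟨ cong (fromℕ m +_) (-‿inverseˡ (fromℕ n)) ⟨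
    fromℕ m + (- fromℕ n + fromℕ n) ≡⟨ +-assoc (fromℕ m) (- fromℕ n) (fromℕ n) ⟨
    fromℕ m - fromℕ n + fromℕ n     ∎)

  fromℤ-neg : ∀ i → fromℤ (ℤ.- i) ≡ - fromℤ i
  fromℤ-neg (ℤ.+ zero)  = sym -0#≈0#
  fromℤ-neg (ℤ.+ suc n) = refl
  fromℤ-neg -[1+ n ]  = sym (-‿involutive _)

  fromℤ-⊖ : ∀ m n → fromℤ (m ⊖ n) ≡ fromℕ m - fromℕ n
  fromℤ-⊖ m n with ℕP.≤-<-connex n m
  ... | inj₁ n≤m = trans (cong fromℤ (ℤP.⊖-≥ n≤m)) (fromℕ-∸ n≤m)
  ... | inj₂ m<n = begin
    fromℤ (m ⊖ n)                ≡⟨ cong fromℤ (ℤP.⊖-< m<n) ⟩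
    fromℤ (ℤ.- (ℤ.+ (n ℕ.∸ m)))  ≡⟨ fromℤ-neg (ℤ.+ (n ℕ.∸ m)) ⟩
    - fromℕ (n ℕ.∸ m)            ≡⟨ cong -_ (fromℕ-∸ (ℕP.<⇒≤ m<n)) ⟩
    - (fromℕ n - fromℕ m)        ≡⟨ -‿+-comm (fromℕ n) (- fromℕ m) ⟨
    - fromℕ n + - - fromℕ m      ≡⟨ cong (- fromℕ n +_) (-‿involutive (fromℕ m)) ⟩
    - fromℕ n + fromℕ m          ≡⟨ +-comm (- fromℕ n) (fromℕ m) ⟩
    fromℕ m - fromℕ n            ∎

  fromℤ-+ : ∀ i j → fromℤ (i ℤ.+ j) ≡ fromℤ i + fromℤ j
  fromℤ-+ -[1+ m ] -[1+ n ] = begin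
    - fromℕ (suc (suc (m ℕ.+ n)))     ≡⟨ cong (λ k → - fromℕ (suc k)) (ℕP.+-suc m n) ⟨
    - fromℕ (suc m ℕ.+ suc n)         ≡⟨ cong -_ (fromℕ-+ (suc m) (suc n)) ⟩
    - (fromℕ (suc m) + fromℕ (suc n)) ≡⟨ -‿+-comm _ _ ⟨
    - fromℕ (suc m) + - fromℕ (suc n) ∎
  fromℤ-+ -[1+ m ] (ℤ.+ n)    = trans (fromℤ-⊖ n (suc m)) (+-comm _ _)
  fromℤ-+ (ℤ.+ m)    -[1+ n ] = fromℤ-⊖ m (suc n)
  fromℤ-+ (ℤ.+ m)    (ℤ.+ n)    = fromℕ-+ m n

  signValue : Sign → Carrier
  signValue Sign.+ = 1#
  signValue Sign.- = - 1#

  signValue-* : ∀ s t → signValue (s Sign.* t) ≡ signValue s * signValue t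
  signValue-* Sign.- Sign.- = trans (sym (-‿involutive 1#)) (sym (-1*x≈-x (- 1#)))
  signValue-* Sign.- Sign.+ = sym (*-identityʳ _)
  signValue-* Sign.+ _      = sym (*-identityˡ _)

  fromℤ-◃ : ∀ s n → fromℤ (s ◃ n) ≡ signValue s * fromℕ n
  fromℤ-◃ s        zero    = sym (zeroʳ _)
  fromℤ-◃ Sign.+ (suc n) = sym (*-identityˡ _)
  fromℤ-◃ Sign.- (suc n) = sym (-1*x≈-x _)

  fromℤ≗sign*abs : ∀ i → fromℤ i ≡ signValue (ℤ.sign i) * fromℕ ℤ.∣ i ∣
  fromℤ≗sign*abs (ℤ.+ n)    = sym (*-identityˡ _)
  fromℤ≗sign*abs -[1+ n ] = sym (-1*x≈-x _)

  fromℤ-* : ∀ i j → fromℤ (i ℤ.* j) ≡ fromℤ i * fromℤ j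
  fromℤ-* i j = begin
    fromℤ (i ℤ.* j)
      ≡⟨ fromℤ-◃ (sign i Sign.* sign j) (∣ i ∣ ℕ.* ∣ j ∣) ⟩
    signValue (sign i Sign.* sign j) * fromℕ (∣ i ∣ ℕ.* ∣ j ∣)
      ≡⟨ cong₂ _*_ (signValue-* (sign i) (sign j)) (fromℕ-* ∣ i ∣ ∣ j ∣) ⟩
    (signValue (sign i) * signValue (sign j)) * (fromℕ ∣ i ∣ * fromℕ ∣ j ∣)
      ≡⟨ interchange _ _ _ _ ⟩
    (signValue (sign i) * fromℕ ∣ i ∣) * (signValue (sign j) * fromℕ ∣ j ∣)
      ≡⟨ cong₂ _*_ (fromℤ≗sign*abs i) (fromℤ≗sign*abs j) ⟨
    fromℤ i * fromℤ j ∎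

  fromℤ-homomorphism : ℤ.+-*-rawRing ACR.-Raw-AlmostCommutative⟶ ACR.fromCommutativeRing commutativeRing
  fromℤ-homomorphism = record
    { ⟦_⟧    = fromℤ
    ; +-homo = fromℤ-+
    ; *-homo = fromℤ-*
    ; -‿homo = fromℤ-neg
    ; 0-homo = refl
    ; 1-homo = +-identityʳ 1#
    }

  fromℤ-≟ : ∀ i j → Maybe (fromℤ i ≡ fromℤ j)
  fromℤ-≟ i j with i ℤ.≟ j
  ... | yes refl = just refl
  ... | no _     = nothing

  open import Algebra.Solver.Ring ℤ.+-*-rawRing (ACR.fromCommutativeRing commutativeRing)
    fromℤ-homomorphism fromℤ-≟ public
    using (solve; _:=_; _:+_; _:*_; _:-_; :-_; con; Polynomial)

  -- Solver constants are read through fromℤ, so # k reduces to the numeral fromℕ k = 1# + (… + 0#);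
  -- an occurrence of 1# itself must first be rewritten to fromℕ 1.
  #_ : ∀ {n} → ℕ → Polynomial n
  # k = con (ℤ.+ k)

  -- An equation p ≡ 0 implied by hypotheses hᵢ ≡ 0 is proved by writing p as a combination of the hᵢ,
  -- the identity being checked by the ring solver.
  combination₁-zero : ∀ {p h} a → p ≡ a * h → h ≡ 0# → p ≡ 0#
  combination₁-zero a p≡ refl = trans p≡ (zeroʳ a)

  combination₂-zero : ∀ {p h₁ h₂} a b → p ≡ a * h₁ + b * h₂ → h₁ ≡ 0# → h₂ ≡ 0# → p ≡ 0#
  combination₂-zero a b p≡ refl refl = trans p≡ (solve 2 (λ a b → a :* # 0 :+ b :* # 0 := # 0) refl a b)

  combination₃-zero : ∀ {p h₁ h₂ h₃} a b c → p ≡ a * h₁ + b * h₂ + c * h₃ →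
                      h₁ ≡ 0# → h₂ ≡ 0# → h₃ ≡ 0# → p ≡ 0#
  combination₃-zero a b c p≡ refl refl refl =
    trans p≡ (solve 3 (λ a b c → a :* # 0 :+ b :* # 0 :+ c :* # 0 := # 0) refl a b c)

  x-y≡0⇒x≡y : ∀ {x y} → x - y ≡ 0# → x ≡ y
  x-y≡0⇒x≡y = x∙y⁻¹≈ε⇒x≈y _ _

  1≢0 : fromℕ 1 ≢ 0#
  1≢0 1≡0 = 0≢1 (sym (trans (sym (+-identityʳ 1#)) 1≡0))

  -x≡0⇒x≡0 : ∀ {x} → - x ≡ 0# → x ≡ 0#
  -x≡0⇒x≡0 {x} -x≡0 = trans (sym (-‿involutive x)) (trans (cong -_ -x≡0) -0#≈0#)

  x≡y⇒x-y≡0 : ∀ {x y} → x ≡ y → x - y ≡ 0#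
  x≡y⇒x-y≡0 = x≈y⇒x∙y⁻¹≈ε

  x*x⁻¹≡1 : ∀ {x} → x ≢ 0# → x * x ⁻¹ ≡ fromℕ 1
  x*x⁻¹≡1 x≢0 = trans (inverseʳ _ x≢0) (sym (+-identityʳ 1#))

  x*y≡0⇒x≡0⊎y≡0 : ∀ {x y} → x * y ≡ 0# → x ≡ 0# ⊎ y ≡ 0#
  x*y≡0⇒x≡0⊎y≡0 {x} {y} xy≡0 with x ≟ 0#
  ... | yes x≡0 = inj₁ x≡0
  ... | no  x≢0 = inj₂ (begin
    y
      ≡⟨ solve 3 (λ x x⁻¹ y → y := (# 1 :- x :* x⁻¹) :* y :+ x⁻¹ :* (x :* y)) refl x (x ⁻¹) y ⟩
    (fromℕ 1 - x * x ⁻¹) * y + x ⁻¹ * (x * y)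
      ≡⟨ cong₂ (λ u v → (fromℕ 1 - u) * y + x ⁻¹ * v) (x*x⁻¹≡1 x≢0) xy≡0 ⟩
    (fromℕ 1 - fromℕ 1) * y + x ⁻¹ * 0#
      ≡⟨ solve 2 (λ x⁻¹ y → (# 1 :- # 1) :* y :+ x⁻¹ :* # 0 := # 0) refl (x ⁻¹) y ⟩
    0# ∎)

  x≢0⇒x*y≡0⇒y≡0 : ∀ {x y} → x ≢ 0# → x * y ≡ 0# → y ≡ 0#
  x≢0⇒x*y≡0⇒y≡0 x≢0 xy≡0 with x*y≡0⇒x≡0⊎y≡0 xy≡0
  ... | inj₁ x≡0 = ⊥-elim (x≢0 x≡0)
  ... | inj₂ y≡0 = y≡0

  y≢0⇒x*y≡0⇒x≡0 : ∀ {x y} → y ≢ 0# → x * y ≡ 0# → x ≡ 0#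
  y≢0⇒x*y≡0⇒x≡0 y≢0 xy≡0 = x≢0⇒x*y≡0⇒y≡0 y≢0 (trans (*-comm _ _) xy≡0)

  x≢0∧y≢0⇒x*y≢0 : ∀ {x y} → x ≢ 0# → y ≢ 0# → x * y ≢ 0#
  x≢0∧y≢0⇒x*y≢0 x≢0 y≢0 xy≡0 = y≢0 (x≢0⇒x*y≡0⇒y≡0 x≢0 xy≡0)

  ∈-elements : ∀ x → x ∈ elements
  ∈-elements x = subst (_∈ elements) (Inverse.strictlyInverseˡ enum x) (∈-map⁺ (Inverse.to enum) (∈-allFin _))

  elements-unique : Unique elements
  elements-unique = Unique.map⁺ injective (Unique.allFin⁺ q)
    where
    injective : ∀ {i j} → Inverse.to enum i ≡ Inverse.to enum j → i ≡ j
    injective {i} {j} eq = trans (sym (Inverse.strictlyInverseʳ enum i))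
                                 (trans (cong (Inverse.from enum) eq) (Inverse.strictlyInverseʳ enum j))

  length-elements : length elements ≡ q
  length-elements = trans (length-map _ (allFin q)) (length-tabulate {n = q} (λ i → i))

  open DecMembership _≟_ using (_∈?_)

  except : List Carrier → List Carrier
  except L = filter (λ x → ¬? (x ∈? L)) elements

  ∈-except⁺ : ∀ {L x} → All (x ≢_) L → x ∈ except L
  ∈-except⁺ x≢L = ∈-filter⁺ (λ x → ¬? (x ∈? _)) (∈-elements _) (All¬⇒¬Any x≢L)

  ∈-except⁻ : ∀ {L x} → x ∈ except L → All (x ≢_) L
  ∈-except⁻ {L} x∈ = ¬Any⇒All¬ L (proj₂ (∈-filter⁻ (λ x → ¬? (x ∈? L)) {xs = elements} x∈))

  ∈-except⇒≢ : ∀ {L x y} → x ∈ except L → y ∈ L → x ≢ y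
  ∈-except⇒≢ x∈ y∈L = All.lookup (∈-except⁻ x∈) y∈L

  except-unique : ∀ L → Unique (except L)
  except-unique L = Unique.filter⁺ (λ x → ¬? (x ∈? L)) elements-unique

  length-except : ∀ {L} → Unique L → length (except L) ℕ.+ length L ≡ q
  length-except {L} L! = begin
    length (except L) ℕ.+ length L                         ≡⟨ ℕP.+-comm (length (except L)) _ ⟩
    length L ℕ.+ length (except L)                         ≡⟨ cong (ℕ._+ length (except L)) L-part ⟨
    length (filter (_∈? L) elements) ℕ.+ length (except L) ≡⟨ length-filter+length-filter-∁ (_∈? L) elements ⟩
    length elements                                        ≡⟨ length-elements ⟩
    q                                                      ∎
    where
    L-part : length (filter (_∈? L) elements) ≡ length L
    L-part = unique-⇔⇒length≡ (Unique.filter⁺ (_∈? L) elements-unique) L!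
      (mk⇔ (λ x∈ → proj₂ (∈-filter⁻ (_∈? L) {xs = elements} x∈)) (∈-filter⁺ (_∈? L) (∈-elements _)))

  Square : Carrier → Set
  Square y = ∃[ z ] z * z ≡ y

  square? : ∀ y → Dec (Square y)
  square? y with Any.any? (λ z → (z * z) ≟ y) elements
  ... | yes z*z≡y = yes (let z , _ , eq = find z*z≡y in z , eq)
  ... | no  ¬z*z≡y = no λ (z , eq) → ¬z*z≡y (lose (∈-elements z) eq)

  isSquare⇒Square : ∀ {y} → isSquare y ≡ true → Square y
  isSquare⇒Square {y} eq = witness (find (any⁻ _ elements (Equivalence.from T-≡ eq)))
    where
    witness : ∃[ z ] z ∈ elements × T (does ((z * z) ≟ y)) → Square y
    witness (z , _ , _) with (z * z) ≟ y
    ... | yes z*z≡y = z , z*z≡y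

  Square⇒isSquare : ∀ {y} → Square y → isSquare y ≡ true
  Square⇒isSquare {y} (z , z*z≡y) = Equivalence.to T-≡ (any⁺ _ (lose (∈-elements z) (decided ((z * z) ≟ y))))
    where
    decided : (d : Dec (z * z ≡ y)) → T (does d)
    decided (yes _)      = tt
    decided (no z*z≢y)   = z*z≢y z*z≡y

  η-0 : fromℤ (η 0#) ≡ 0#
  η-0 with 0# ≟ 0#
  ... | yes _   = refl
  ... | no 0≢0 = ⊥-elim (0≢0 refl)

  η-square : ∀ {y} → y ≢ 0# → Square y → fromℤ (η y) ≡ fromℕ 1
  η-square {y} y≢0 y□ with y ≟ 0#
  ... | yes y≡0 = ⊥-elim (y≢0 y≡0)
  ... | no  _   rewrite Square⇒isSquare y□ = refl

  η-nonsquare : ∀ {y} → ¬ Square y → fromℤ (η y) ≡ - fromℕ 1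
  η-nonsquare {y} ¬y□ with y ≟ 0#
  ... | yes y≡0 = ⊥-elim (¬y□ (0# , trans (zeroˡ 0#) (sym y≡0)))
  ... | no  _ with isSquare y in eq
  ...   | true  = ⊥-elim (¬y□ (isSquare⇒Square eq))
  ...   | false = refl

  data QuadraticCharacterView (y : Carrier) : Set where
    zero      : y ≡ 0# → fromℤ (η y) ≡ 0# → QuadraticCharacterView y
    square    : y ≢ 0# → Square y → fromℤ (η y) ≡ fromℕ 1 → QuadraticCharacterView y
    nonsquare : ¬ Square y → fromℤ (η y) ≡ - fromℕ 1 → QuadraticCharacterView y

  η-view : ∀ y → QuadraticCharacterView y
  η-view y with y ≟ 0# | square? y
  ... | yes y≡0 | _      = zero y≡0 (subst (λ u → fromℤ (η u) ≡ 0#) (sym y≡0) η-0)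
  ... | no  y≢0 | yes y□ = square y≢0 y□ (η-square y≢0 y□)
  ... | no  _   | no ¬y□ = nonsquare ¬y□ (η-nonsquare ¬y□)

  δ≡length : ∀ {F a b L} → Unique L → (∀ {x} → F (x + a) - F x ≡ b ⇔ x ∈ L) → δ F a b ≡ length L
  δ≡length {F} {a} {b} L! solves⇔∈L = unique-⇔⇒length≡ (Unique.filter⁺ P? elements-unique) L! (mk⇔
    (λ x∈ → Equivalence.to solves⇔∈L (proj₂ (∈-filter⁻ P? {xs = elements} x∈)))
    (λ x∈L → ∈-filter⁺ P? (∈-elements _) (Equivalence.from solves⇔∈L x∈L)))
    where
    P? = λ x → (F (x + a) - F x) ≟ b

∣-offset⇒%≡ : ∀ {d s c q} .{{_ : NonZero d}} → d ∣ s → s ℕ.+ c ≡ q → q % d ≡ c % d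
∣-offset⇒%≡ {d} {c = c} (divides k refl) refl = trans (cong (_% d) (ℕP.+-comm (k ℕ.* d) c)) ([m+kn]%n≡m%n c k d)

module CyclicActions {q : ℕ} (K : FiniteField q) where
  open FiniteField K
  open FieldProperties K

  characteristic⇒q≡0[n] : ∀ m → fromℕ (suc m) ≡ 0# → (∀ k → 0 < k → k < suc m → fromℕ k ≢ 0#) →
                          q % suc m ≡ 0
  characteristic⇒q≡0[n] m n≡0 k≢0 =
    ∣-offset⇒%≡ (free-cyclic⇒n∣length _≟_ elements-unique translation)
                (trans (ℕP.+-identityʳ _) length-elements)
    where
    fold-translate : ∀ x k → fold x (1# +_) k ≡ fromℕ k + x
    fold-translate x zero    = sym (+-identityˡ x)
    fold-translate x (suc k) = trans (cong (1# +_) (fold-translate x k)) (sym (+-assoc 1# (fromℕ k) x))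

    translation : IsFreeCyclicAction (1# +_) (suc m) elements
    translation = record
      { closed = λ _ → ∈-elements _
      ; period = λ {x} _ → trans (fold-translate x (suc m)) (trans (cong (_+ x) n≡0) (+-identityˡ x))
      ; free   = λ {x} _ k 0<k k<n k+x≡x → k≢0 k 0<k k<n
                   (+-cancelʳ x _ _ (trans (sym (fold-translate x k)) (trans k+x≡x (sym (+-identityˡ x)))))
      }

  _^_ : Carrier → ℕ → Carrier
  ζ ^ k = fold (fromℕ 1) (ζ *_) k

  root-of-unity⇒q≡1[n] : ∀ {ζ} m → ζ ^ suc m ≡ fromℕ 1 →
                         (∀ k → 0 < k → k < suc m → ζ ^ k ≢ fromℕ 1) → q % suc m ≡ 1 % suc m
  root-of-unity⇒q≡1[n] {ζ} m ζⁿ≡1 ζᵏ≢1 =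
    ∣-offset⇒%≡ (free-cyclic⇒n∣length _≟_ (except-unique _) rotation) (length-except ([] ∷ []))
    where
    fold-scale : ∀ x k → fold x (ζ *_) k ≡ ζ ^ k * x
    fold-scale x zero    = solve 1 (λ x → x := # 1 :* x) refl x
    fold-scale x (suc k) = trans (cong (ζ *_) (fold-scale x k)) (sym (*-assoc ζ (ζ ^ k) x))

    ζ≢0 : ζ ≢ 0#
    ζ≢0 ζ≡0 = 1≢0 (trans (sym ζⁿ≡1) (trans (cong (_* (ζ ^ m)) ζ≡0) (zeroˡ _)))

    rotation : IsFreeCyclicAction (ζ *_) (suc m) (except (0# ∷ []))
    rotation = record
      { closed = λ x∈ → ∈-except⁺ (x≢0∧y≢0⇒x*y≢0 ζ≢0 (∈-except⇒≢ x∈ (here refl)) ∷ [])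
      ; period = λ {x} _ → trans (fold-scale x (suc m))
                             (trans (cong (_* x) ζⁿ≡1) (solve 1 (λ x → # 1 :* x := x) refl x))
      ; free   = λ {x} x∈ k 0<k k<n ζᵏx≡x → ζᵏ≢1 k 0<k k<n
                   (x-y≡0⇒x≡y (y≢0⇒x*y≡0⇒x≡0 (∈-except⇒≢ x∈ (here refl))
                     (combination₁-zero (fromℕ 1)
                       (solve 2 (λ u x → (u :- # 1) :* x := # 1 :* (u :* x :- x)) refl (ζ ^ k) x)
                       (x≡y⇒x-y≡0 (trans (sym (fold-scale x k)) ζᵏx≡x)))))
      }

module SquareClasses {q : ℕ} (K : FiniteField q) (q≡7[8] : q % 8 ≡ 7) where
  open FiniteField K
  open FieldProperties K
  open CyclicActions K

  q≡1[2] : q % 2 ≡ 1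
  q≡1[2] = trans (sym (m∣n⇒o%n%m≡o%m 2 8 q (divides 4 refl))) (cong (_% 2) q≡7[8])

  q≡3[4] : q % 4 ≡ 3
  q≡3[4] = trans (sym (m∣n⇒o%n%m≡o%m 4 8 q (divides 2 refl))) (cong (_% 4) q≡7[8])

  2≢0 : fromℕ 2 ≢ 0#
  2≢0 2≡0 = contradiction (trans (sym q≡1[2]) (characteristic⇒q≡0[n] 1 2≡0 k≢0)) λ ()
    where
    k≢0 : ∀ k → 0 < k → k < 2 → fromℕ k ≢ 0#
    k≢0 1 _ _ = 1≢0
    k≢0 (suc (suc _)) _ (s≤s (s≤s ()))

  3≢0 : q % 3 ≢ 0 → fromℕ 3 ≢ 0#
  3≢0 q≢0[3] 3≡0 = q≢0[3] (characteristic⇒q≡0[n] 2 3≡0 k≢0)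
    where
    k≢0 : ∀ k → 0 < k → k < 3 → fromℕ k ≢ 0#
    k≢0 1 _ _ = 1≢0
    k≢0 2 _ _ = 2≢0
    k≢0 (suc (suc (suc _))) _ (s≤s (s≤s (s≤s ())))

  ¬Square[-1] : ¬ Square (- fromℕ 1)
  ¬Square[-1] (i , i²≡-1) = contradiction (trans (sym q≡3[4]) (root-of-unity⇒q≡1[n] 3 i⁴≡1 iᵏ≢1)) λ ()
    where
    i²+1≡0 : i * i - - fromℕ 1 ≡ 0#
    i²+1≡0 = x≡y⇒x-y≡0 i²≡-1

    i⁴≡1 : i ^ 4 ≡ fromℕ 1
    i⁴≡1 = x-y≡0⇒x≡y (combination₁-zero (i * i - fromℕ 1)
      (solve 1 (λ i → i :* (i :* (i :* (i :* # 1))) :- # 1 := (i :* i :- # 1) :* (i :* i :- :- # 1)) refl i) i²+1≡0)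

    iᵏ≢1 : ∀ k → 0 < k → k < 4 → i ^ k ≢ fromℕ 1
    iᵏ≢1 1 _ _ i≡1 = 2≢0 (combination₂-zero (- (i + fromℕ 1)) (fromℕ 1)
      (solve 1 (λ i → # 2 := :- (i :+ # 1) :* (i :* # 1 :- # 1) :+ # 1 :* (i :* i :- :- # 1)) refl i)
      (x≡y⇒x-y≡0 i≡1) i²+1≡0)
    iᵏ≢1 2 _ _ i²≡1 = 2≢0 (combination₂-zero (- fromℕ 1) (fromℕ 1)
      (solve 1 (λ i → # 2 := :- # 1 :* (i :* (i :* # 1) :- # 1) :+ # 1 :* (i :* i :- :- # 1)) refl i)
      (x≡y⇒x-y≡0 i²≡1) i²+1≡0)
    iᵏ≢1 3 _ _ i³≡1 = 2≢0 (combination₂-zero (i - fromℕ 1) (fromℕ 1 - i * (i - fromℕ 1))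
      (solve 1 (λ i → # 2 := (i :- # 1) :* (i :* (i :* (i :* # 1)) :- # 1)
                           :+ (# 1 :- i :* (i :- # 1)) :* (i :* i :- :- # 1)) refl i)
      (x≡y⇒x-y≡0 i³≡1) i²+1≡0)
    iᵏ≢1 (suc (suc (suc (suc _)))) _ (s≤s (s≤s (s≤s (s≤s ()))))

  ¬Square[-3] : q % 3 ≡ 2 → ¬ Square (- fromℕ 3)
  ¬Square[-3] q≡2[3] (s , s²≡-3) =
    contradiction (trans (sym q≡2[3]) (root-of-unity⇒q≡1[n] 2 ω³≡1 ωᵏ≢1)) λ ()
    where
    3≢0′ : fromℕ 3 ≢ 0#
    3≢0′ = 3≢0 (λ q≡0[3] → contradiction (trans (sym q≡2[3]) q≡0[3]) λ ())

    ω : Carrier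
    ω = (s - fromℕ 1) * fromℕ 2 ⁻¹

    ω²+ω+1≡0 : ω * ω + ω + fromℕ 1 ≡ 0#
    ω²+ω+1≡0 = combination₂-zero (fromℕ 2 ⁻¹ * fromℕ 2 ⁻¹) (- fromℕ 1 - (s + fromℕ 1) * fromℕ 2 ⁻¹)
      (solve 2 (λ s h → ((s :- # 1) :* h) :* ((s :- # 1) :* h) :+ (s :- # 1) :* h :+ # 1
                        := (h :* h) :* (s :* s :- :- # 3) :+ (:- # 1 :- (s :+ # 1) :* h) :* (# 2 :* h :- # 1))
             refl s (fromℕ 2 ⁻¹))
      (x≡y⇒x-y≡0 s²≡-3) (x≡y⇒x-y≡0 (x*x⁻¹≡1 2≢0))

    ω³≡1 : ω ^ 3 ≡ fromℕ 1
    ω³≡1 = x-y≡0⇒x≡y (combination₁-zero (ω - fromℕ 1)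
      (solve 1 (λ w → w :* (w :* (w :* # 1)) :- # 1 := (w :- # 1) :* (w :* w :+ w :+ # 1)) refl ω) ω²+ω+1≡0)

    ωᵏ≢1 : ∀ k → 0 < k → k < 3 → ω ^ k ≢ fromℕ 1
    ωᵏ≢1 1 _ _ ω≡1 = 3≢0′ (combination₂-zero (- (ω + fromℕ 2)) (fromℕ 1)
      (solve 1 (λ w → # 3 := :- (w :+ # 2) :* (w :* # 1 :- # 1) :+ # 1 :* (w :* w :+ w :+ # 1)) refl ω)
      (x≡y⇒x-y≡0 ω≡1) ω²+ω+1≡0)
    ωᵏ≢1 2 _ _ ω²≡1 = 3≢0′ (combination₂-zero (ω - fromℕ 1) (- (ω - fromℕ 2))
      (solve 1 (λ w → # 3 := (w :- # 1) :* (w :* (w :* # 1) :- # 1) :+ :- (w :- # 2) :* (w :* w :+ w :+ # 1)) refl ω)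
      (x≡y⇒x-y≡0 ω²≡1) ω²+ω+1≡0)
    ωᵏ≢1 (suc (suc (suc _))) _ (s≤s (s≤s (s≤s ())))

  module MöbiusOrder3 (¬□-3 : ¬ Square (- fromℕ 3)) where

    S : List Carrier
    S = except (0# ∷ fromℕ 1 ∷ [])

    S-complement-unique : Unique (0# ∷ fromℕ 1 ∷ [])
    S-complement-unique = ((λ 0≡1 → 1≢0 (sym 0≡1)) ∷ []) ∷ [] ∷ []

    τ : Carrier → Carrier
    τ t = (fromℕ 1 - t) ⁻¹

    τ-def : ∀ {t} → t ∈ S → τ t * (fromℕ 1 - t) - fromℕ 1 ≡ 0#
    τ-def t∈ = x≡y⇒x-y≡0 (trans (*-comm _ _)
      (x*x⁻¹≡1 (λ 1-t≡0 → ∈-except⇒≢ t∈ (there (here refl)) (sym (x-y≡0⇒x≡y 1-t≡0)))))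

    τ-closed : ∀ {t} → t ∈ S → τ t ∈ S
    τ-closed {t} t∈ = ∈-except⁺ (τt≢0 ∷ τt≢1 ∷ [])
      where
      τt≢0 : τ t ≢ 0#
      τt≢0 τt≡0 = 1≢0 (combination₂-zero (- fromℕ 1) (fromℕ 1 - t)
        (solve 2 (λ t y → # 1 := :- # 1 :* (y :* (# 1 :- t) :- # 1) :+ (# 1 :- t) :* y) refl t (τ t))
        (τ-def t∈) τt≡0)
      τt≢1 : τ t ≢ fromℕ 1
      τt≢1 τt≡1 = ∈-except⇒≢ t∈ (here refl) (combination₂-zero (- fromℕ 1) (fromℕ 1 - t)
        (solve 2 (λ t y → t := :- # 1 :* (y :* (# 1 :- t) :- # 1) :+ (# 1 :- t) :* (y :- # 1)) refl t (τ t))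
        (τ-def t∈) (x≡y⇒x-y≡0 τt≡1))

    τ³≡id : ∀ {t} → t ∈ S → fold t τ 3 ≡ t
    τ³≡id {t} t∈ = x-y≡0⇒x≡y (combination₃-zero (- (w * z)) (- (w * (fromℕ 1 - t))) t
      (solve 4 (λ t y z w → w :- t := :- (w :* z) :* (y :* (# 1 :- t) :- # 1)
                                     :+ :- (w :* (# 1 :- t)) :* (z :* (# 1 :- y) :- # 1)
                                     :+ t :* (w :* (# 1 :- z) :- # 1)) refl t y z w)
      (τ-def t∈) (τ-def (τ-closed t∈)) (τ-def (τ-closed (τ-closed t∈))))
      where
      y = τ t
      z = τ y
      w = τ z

    -- A fixed point t would give the square root 2t - 1 of -3.
    τ-no-fixpoint : ∀ {t} → t ∈ S → τ t ≢ t
    τ-no-fixpoint {t} t∈ τt≡t = ¬□-3 (fromℕ 2 * t - fromℕ 1 , x-y≡0⇒x≡y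
      (combination₂-zero (- fromℕ 4) (fromℕ 4 * (fromℕ 1 - t))
        (solve 2 (λ t y → (# 2 :* t :- # 1) :* (# 2 :* t :- # 1) :- :- # 3
                          := :- # 4 :* (y :* (# 1 :- t) :- # 1) :+ (# 4 :* (# 1 :- t)) :* (y :- t)) refl t (τ t))
        (τ-def t∈) (x≡y⇒x-y≡0 τt≡t)))

    τ-action : IsFreeCyclicAction τ 3 S
    τ-action = record { closed = τ-closed ; period = τ³≡id ; free = free }
      where
      free : ∀ {t} → t ∈ S → ∀ k → 0 < k → k < 3 → fold t τ k ≢ t
      free t∈ 1 _ _ = τ-no-fixpoint t∈
      free t∈ 2 _ _ τ²t≡t = τ-no-fixpoint t∈ (trans (cong τ (sym τ²t≡t)) (τ³≡id t∈))
      free _ (suc (suc (suc _))) _ (s≤s (s≤s (s≤s ())))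

  Square[-3] : q % 3 ≡ 1 → Square (- fromℕ 3)
  Square[-3] q≡1[3] with square? (- fromℕ 3)
  ... | yes □-3 = □-3
  ... | no ¬□-3 = contradiction (trans (sym q≡1[3])
    (∣-offset⇒%≡ (free-cyclic⇒n∣length _≟_ (except-unique _) τ-action)
                 (length-except S-complement-unique))) λ ()
    where open MöbiusOrder3 ¬□-3

  module MöbiusDihedral (¬□2 : ¬ Square (fromℕ 2)) where

    S : List Carrier
    S = except (0# ∷ fromℕ 1 ∷ - fromℕ 1 ∷ [])

    S-complement-unique : Unique (0# ∷ fromℕ 1 ∷ - fromℕ 1 ∷ [])
    S-complement-unique = ((λ 0≡1 → 1≢0 (sym 0≡1)) ∷ 0≢-1 ∷ []) ∷ (1≢-1 ∷ []) ∷ [] ∷ []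
      where
      0≢-1 : 0# ≢ - fromℕ 1
      0≢-1 0≡-1 = 1≢0 (-x≡0⇒x≡0 (sym 0≡-1))
      1≢-1 : fromℕ 1 ≢ - fromℕ 1
      1≢-1 1≡-1 = 2≢0 (trans (solve 0 (# 2 := # 1 :- :- # 1) refl) (x≡y⇒x-y≡0 1≡-1))

    ≢0 : ∀ {t} → t ∈ S → t ≢ 0#
    ≢0 t∈ = ∈-except⇒≢ t∈ (here refl)

    ≢1 : ∀ {t} → t ∈ S → t ≢ fromℕ 1
    ≢1 t∈ = ∈-except⇒≢ t∈ (there (here refl))

    ≢-1 : ∀ {t} → t ∈ S → t ≢ - fromℕ 1
    ≢-1 t∈ = ∈-except⇒≢ t∈ (there (there (here refl)))

    ρ σ : Carrier → Carrier
    ρ t = (fromℕ 1 + t) * (fromℕ 1 - t) ⁻¹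
    σ t = - t

    ρ-def : ∀ {t} → t ∈ S → ρ t * (fromℕ 1 - t) - (fromℕ 1 + t) ≡ 0#
    ρ-def {t} t∈ = x≡y⇒x-y≡0 (begin
      (fromℕ 1 + t) * (fromℕ 1 - t) ⁻¹ * (fromℕ 1 - t)
        ≡⟨ *-assoc _ _ _ ⟩
      (fromℕ 1 + t) * ((fromℕ 1 - t) ⁻¹ * (fromℕ 1 - t))
        ≡⟨ cong ((fromℕ 1 + t) *_) (trans (*-comm _ _) (x*x⁻¹≡1 1-t≢0)) ⟩
      (fromℕ 1 + t) * fromℕ 1
        ≡⟨ solve 1 (λ t → (# 1 :+ t) :* # 1 := # 1 :+ t) refl t ⟩
      fromℕ 1 + t ∎)
      where
      open ≡-Reasoning
      1-t≢0 : fromℕ 1 - t ≢ 0#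
      1-t≢0 1-t≡0 = ≢1 t∈ (sym (x-y≡0⇒x≡y 1-t≡0))

    ρ-closed : ∀ {t} → t ∈ S → ρ t ∈ S
    ρ-closed {t} t∈ = ∈-except⁺ (ρt≢0 ∷ ρt≢1 ∷ ρt≢-1 ∷ [])
      where
      ρt≢0 : ρ t ≢ 0#
      ρt≢0 ρt≡0 = ≢-1 t∈ (x-y≡0⇒x≡y (combination₂-zero (- fromℕ 1) (fromℕ 1 - t)
        (solve 2 (λ t y → t :- :- # 1 := :- # 1 :* (y :* (# 1 :- t) :- (# 1 :+ t)) :+ (# 1 :- t) :* y) refl t (ρ t))
        (ρ-def t∈) ρt≡0))
      ρt≢1 : ρ t ≢ fromℕ 1
      ρt≢1 ρt≡1 = ≢0 t∈ (x≢0⇒x*y≡0⇒y≡0 2≢0 (combination₂-zero (- fromℕ 1) (fromℕ 1 - t)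
        (solve 2 (λ t y → # 2 :* t := :- # 1 :* (y :* (# 1 :- t) :- (# 1 :+ t)) :+ (# 1 :- t) :* (y :- # 1))
               refl t (ρ t))
        (ρ-def t∈) (x≡y⇒x-y≡0 ρt≡1)))
      ρt≢-1 : ρ t ≢ - fromℕ 1
      ρt≢-1 ρt≡-1 = 2≢0 (combination₂-zero (- fromℕ 1) (fromℕ 1 - t)
        (solve 2 (λ t y → # 2 := :- # 1 :* (y :* (# 1 :- t) :- (# 1 :+ t)) :+ (# 1 :- t) :* (y :- :- # 1)) refl t (ρ t))
        (ρ-def t∈) (x≡y⇒x-y≡0 ρt≡-1))

    ρ²t*t≡-1 : ∀ {t} → t ∈ S → ρ (ρ t) * t + fromℕ 1 ≡ 0#
    ρ²t*t≡-1 {t} t∈ = x≢0⇒x*y≡0⇒y≡0 2≢0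
      (combination₂-zero (- (ρ (ρ t) + fromℕ 1)) (- (fromℕ 1 - t))
        (solve 3 (λ t y z → # 2 :* (z :* t :+ # 1) := :- (z :+ # 1) :* (y :* (# 1 :- t) :- (# 1 :+ t))
                                                     :+ :- (# 1 :- t) :* (z :* (# 1 :- y) :- (# 1 :+ y)))
               refl t (ρ t) (ρ (ρ t)))
        (ρ-def t∈) (ρ-def (ρ-closed t∈)))

    ρ⁴≡id : ∀ {t} → t ∈ S → fold t ρ 4 ≡ t
    ρ⁴≡id {t} t∈ = x-y≡0⇒x≡y (y≢0⇒x*y≡0⇒x≡0 (≢0 (ρ-closed (ρ-closed t∈)))
      (combination₂-zero (fromℕ 1) (- fromℕ 1)
        (solve 3 (λ t z w → (w :- t) :* z := # 1 :* (w :* z :+ # 1) :+ :- # 1 :* (z :* t :+ # 1))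
               refl t (ρ (ρ t)) (fold t ρ 4))
        (ρ²t*t≡-1 (ρ-closed (ρ-closed t∈))) (ρ²t*t≡-1 t∈)))

    ρ-no-fixpoint : ∀ {t} → t ∈ S → ρ t ≢ t
    ρ-no-fixpoint {t} t∈ ρt≡t = ¬Square[-1] (t , x-y≡0⇒x≡y (combination₂-zero (- fromℕ 1) (fromℕ 1 - t)
      (solve 2 (λ t y → t :* t :- :- # 1 := :- # 1 :* (y :* (# 1 :- t) :- (# 1 :+ t)) :+ (# 1 :- t) :* (y :- t))
             refl t (ρ t))
      (ρ-def t∈) (x≡y⇒x-y≡0 ρt≡t)))

    ρ-free : ∀ {t} → t ∈ S → ∀ k → 0 < k → k < 4 → fold t ρ k ≢ t
    ρ-free t∈ 1 _ _ = ρ-no-fixpoint t∈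
    ρ-free {t} t∈ 2 _ _ ρ²t≡t = ¬Square[-1] (t , x-y≡0⇒x≡y
      (trans (solve 1 (λ t → t :* t :- :- # 1 := t :* t :+ # 1) refl t)
             (subst (λ u → u * t + fromℕ 1 ≡ 0#) ρ²t≡t (ρ²t*t≡-1 t∈))))
    ρ-free t∈ 3 _ _ ρ³t≡t = ρ-no-fixpoint t∈ (trans (cong ρ (sym ρ³t≡t)) (ρ⁴≡id t∈))
    ρ-free _ (suc (suc (suc (suc _)))) _ (s≤s (s≤s (s≤s (s≤s ()))))

    σ-closed : ∀ {t} → t ∈ S → σ t ∈ S
    σ-closed t∈ = ∈-except⁺ ((λ -t≡0 → ≢0 t∈ (neg≡ -t≡0 -0#≈0#))
                          ∷ (λ -t≡1 → ≢-1 t∈ (neg≡ -t≡1 refl))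
                          ∷ (λ -t≡-1 → ≢1 t∈ (neg≡ -t≡-1 (-‿involutive _)))
                          ∷ [])
      where
      neg≡ : ∀ {t u v} → - t ≡ u → - u ≡ v → t ≡ v
      neg≡ {t} -t≡u -u≡v = trans (sym (-‿involutive t)) (trans (cong -_ -t≡u) -u≡v)

    ρσρ≡σ : ∀ {t} → t ∈ S → ρ (σ (ρ t)) ≡ σ t
    ρσρ≡σ {t} t∈ = x-y≡0⇒x≡y (x≢0⇒x*y≡0⇒y≡0 2≢0
      (combination₂-zero (fromℕ 1 - t) (- (v + fromℕ 1))
        (solve 3 (λ t y v → # 2 :* (v :- :- t) := (# 1 :- t) :* (v :* (# 1 :- :- y) :- (# 1 :+ :- y))
                                                :+ :- (v :+ # 1) :* (y :* (# 1 :- t) :- (# 1 :+ t)))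
               refl t (ρ t) v)
        (ρ-def (σ-closed (ρ-closed t∈))) (ρ-def t∈)))
      where v = ρ (σ (ρ t))

    -- Reflections with a fixed point would give the square roots t - 1 (k = 1) and t + 1 (k = 3) of 2.
    σ-free : ∀ {t} → t ∈ S → ∀ k → k < 4 → fold t ρ k ≢ σ t
    σ-free {t} t∈ 0 _ t≡-t = ≢0 t∈ (x≢0⇒x*y≡0⇒y≡0 2≢0
      (trans (solve 1 (λ t → # 2 :* t := t :- :- t) refl t) (x≡y⇒x-y≡0 t≡-t)))
    σ-free {t} t∈ 1 _ ρt≡-t = ¬□2 (t - fromℕ 1 , x-y≡0⇒x≡y
      (combination₂-zero (fromℕ 1) (- (fromℕ 1 - t))
        (solve 2 (λ t y → (t :- # 1) :* (t :- # 1) :- # 2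
                          := # 1 :* (y :* (# 1 :- t) :- (# 1 :+ t)) :+ :- (# 1 :- t) :* (y :- :- t)) refl t (ρ t))
        (ρ-def t∈) (x≡y⇒x-y≡0 ρt≡-t)))
    σ-free {t} t∈ 2 _ ρ²t≡-t =
      [ (λ t-1≡0 → ≢1 t∈ (x-y≡0⇒x≡y t-1≡0)) , (λ t+1≡0 → ≢-1 t∈ (x-y≡0⇒x≡y t+1≡0)) ]
      (x*y≡0⇒x≡0⊎y≡0 (combination₂-zero t (- fromℕ 1)
        (solve 2 (λ t z → (t :- # 1) :* (t :- :- # 1) := t :* (z :- :- t) :+ :- # 1 :* (z :* t :+ # 1))
               refl t (ρ (ρ t)))
        (x≡y⇒x-y≡0 ρ²t≡-t) (ρ²t*t≡-1 t∈)))
    σ-free {t} t∈ 3 _ ρ³t≡-t = ¬□2 (t + fromℕ 1 , x-y≡0⇒x≡y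
      (combination₂-zero (fromℕ 1) (- (fromℕ 1 + t))
        (solve 2 (λ t v → (t :+ # 1) :* (t :+ # 1) :- # 2
                          := # 1 :* (v :* (# 1 :- :- t) :- (# 1 :+ :- t)) :+ :- (# 1 :+ t) :* (v :- t)) refl t (ρ (σ t)))
        (ρ-def (σ-closed t∈)) (x≡y⇒x-y≡0 (trans (cong ρ (sym ρ³t≡-t)) (ρ⁴≡id t∈)))))
    σ-free _ (suc (suc (suc (suc _)))) (s≤s (s≤s (s≤s (s≤s ()))))

    dihedral-action : IsFreeDihedralAction ρ σ 4 S
    dihedral-action = record
      { rotation     = record { closed = ρ-closed ; period = ρ⁴≡id ; free = ρ-free }
      ; s-closed     = σ-closed
      ; s-involutive = λ _ → -‿involutive _
      ; s-inverts    = ρσρ≡σ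
      ; s-free       = σ-free
      }

  Square[2] : Square (fromℕ 2)
  Square[2] with square? (fromℕ 2)
  ... | yes □2 = □2
  ... | no ¬□2 = contradiction (trans (sym q≡7[8])
    (∣-offset⇒%≡ (free-dihedral⇒2n∣length _≟_ (except-unique _) dihedral-action)
                 (length-except S-complement-unique))) λ ()
    where open MöbiusDihedral ¬□2

module Solutions {q : ℕ} (K : FiniteField q) (q≡7[8] : q % 8 ≡ 7) (q≢0[3] : q % 3 ≢ 0) where
  open FiniteField K
  open FieldProperties K
  open SquareClasses K q≡7[8]

  b : Carrier
  b = fromℕ 4 * fromℕ 3 ⁻¹

  e : Carrier → Carrier
  e y = fromℤ (η y)

  Solution : Carrier → Set
  Solution x = x ≡ 0# ⊎ (x ≡ - fromℕ 4 × Square (- fromℕ 3))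

  Δ : Carrier → Carrier → Carrier → Carrier
  Δ x e₀ e₁ = (x + fromℕ 1) * (x + fromℕ 1) * (fromℕ 3 + e₁) - x * x * (fromℕ 3 + e₀) - fromℕ 4

  3*3⁻¹≡1 : fromℕ 3 * fromℕ 3 ⁻¹ - fromℕ 1 ≡ 0#
  3*3⁻¹≡1 = x≡y⇒x-y≡0 (x*x⁻¹≡1 (3≢0 q≢0[3]))

  3*F≡ : ∀ y → fromℕ 3 * F₂,⅓ y ≡ y * y * (fromℕ 3 + e y)
  3*F≡ y = trans (cong (λ o → fromℕ 3 * (y * y * (o + fromℕ 3 ⁻¹ * e y))) (sym (+-identityʳ 1#)))
    (x-y≡0⇒x≡y (combination₁-zero (y * y * e y)
      (solve 3 (λ y c u → # 3 :* ((y :* y) :* (# 1 :+ c :* u)) :- y :* y :* (# 3 :+ u)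
                          := y :* y :* u :* (# 3 :* c :- # 1)) refl y (fromℕ 3 ⁻¹) (e y))
      3*3⁻¹≡1))

  3*b≡4 : fromℕ 3 * b ≡ fromℕ 4
  3*b≡4 = x-y≡0⇒x≡y (combination₁-zero (fromℕ 4)
    (solve 1 (λ c → # 3 :* (# 4 :* c) :- # 4 := # 4 :* (# 3 :* c :- # 1)) refl (fromℕ 3 ⁻¹)) 3*3⁻¹≡1)

  3*-injective : ∀ {u v} → fromℕ 3 * u ≡ fromℕ 3 * v → u ≡ v
  3*-injective {u} {v} 3u≡3v = x-y≡0⇒x≡y (x≢0⇒x*y≡0⇒y≡0 (3≢0 q≢0[3]) (combination₁-zero (fromℕ 1)
    (solve 2 (λ u v → # 3 :* (u :- v) := # 1 :* (# 3 :* u :- # 3 :* v)) refl u v) (x≡y⇒x-y≡0 3u≡3v)))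

  x+1#≡x+1 : ∀ x → x + 1# ≡ x + fromℕ 1
  x+1#≡x+1 x = cong (x +_) (sym (+-identityʳ 1#))

  3*difference : ∀ x → fromℕ 3 * (F₂,⅓ (x + 1#) - F₂,⅓ x) ≡ Δ x (e x) (e (x + 1#)) + fromℕ 4
  3*difference x = begin
    fromℕ 3 * (F₂,⅓ (x + 1#) - F₂,⅓ x)
      ≡⟨ solve 2 (λ u v → # 3 :* (u :- v) := # 3 :* u :- # 3 :* v) refl (F₂,⅓ (x + 1#)) (F₂,⅓ x) ⟩
    fromℕ 3 * F₂,⅓ (x + 1#) - fromℕ 3 * F₂,⅓ x
      ≡⟨ cong₂ _-_ (3*F≡ (x + 1#)) (3*F≡ x) ⟩
    (x + 1#) * (x + 1#) * (fromℕ 3 + e (x + 1#)) - x * x * (fromℕ 3 + e x)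
      ≡⟨ cong (λ y → y * y * (fromℕ 3 + e (x + 1#)) - x * x * (fromℕ 3 + e x)) (x+1#≡x+1 x) ⟩
    (x + fromℕ 1) * (x + fromℕ 1) * (fromℕ 3 + e (x + 1#)) - x * x * (fromℕ 3 + e x)
      ≡⟨ solve 1 (λ g → g := g :- # 4 :+ # 4) refl _ ⟩
    Δ x (e x) (e (x + 1#)) + fromℕ 4 ∎
    where open ≡-Reasoning

  difference≡b⇔Δ≡0 : ∀ x → F₂,⅓ (x + 1#) - F₂,⅓ x ≡ b ⇔ Δ x (e x) (e (x + 1#)) ≡ 0#
  difference≡b⇔Δ≡0 x = mk⇔
    (λ diff≡b → +-cancelʳ (fromℕ 4) _ _
      (trans (sym (3*difference x)) (trans (cong (fromℕ 3 *_) diff≡b) (trans 3*b≡4 (sym (+-identityˡ _))))))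
    (λ Δ≡0 → 3*-injective
      (trans (3*difference x) (trans (cong (_+ fromℕ 4) Δ≡0) (trans (+-identityˡ _) (sym 3*b≡4)))))

  Δ≡0-cong : ∀ {x u u′ v v′} → u ≡ u′ → v ≡ v′ → Δ x u v ≡ 0# → Δ x u′ v′ ≡ 0#
  Δ≡0-cong {x} = subst₂ (λ u v → Δ x u v ≡ 0#)

  Δ≡0-square-square : ∀ {x} → Δ x (fromℕ 1) (fromℕ 1) ≡ 0# → x ≡ 0#
  Δ≡0-square-square {x} Δ≡0 = 2*-zero (2*-zero (2*-zero (trans
    (solve 1 (λ x → # 2 :* (# 2 :* (# 2 :* x))
                    := (x :+ # 1) :* (x :+ # 1) :* (# 3 :+ # 1) :- x :* x :* (# 3 :+ # 1) :- # 4) refl x) Δ≡0)))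
    where
    2*-zero : ∀ {y} → fromℕ 2 * y ≡ 0# → y ≡ 0#
    2*-zero = x≢0⇒x*y≡0⇒y≡0 2≢0

  Δ≡0-square-nonsquare : ∀ {x} → Δ x (fromℕ 1) (- fromℕ 1) ≡ 0# → x ≡ fromℕ 1
  Δ≡0-square-nonsquare {x} Δ≡0 = x-y≡0⇒x≡y (reduce (x*y≡0⇒x≡0⊎y≡0 (x≢0⇒x*y≡0⇒y≡0 2≢0
    (combination₁-zero (- fromℕ 1)
      (solve 1 (λ x → # 2 :* ((x :- # 1) :* (x :- # 1))
                      := :- # 1 :* ((x :+ # 1) :* (x :+ # 1) :* (# 3 :+ :- # 1) :- x :* x :* (# 3 :+ # 1) :- # 4)) refl x)
      Δ≡0))))

  Δ[-1,-1,0]≢0 : Δ (- fromℕ 1) (- fromℕ 1) 0# ≢ 0#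
  Δ[-1,-1,0]≢0 Δ≡0 = x≢0∧y≢0⇒x*y≢0 2≢0 (3≢0 q≢0[3]) (trans
    (solve 0 (# 2 :* # 3 := :- ((:- # 1 :+ # 1) :* (:- # 1 :+ # 1) :* (# 3 :+ # 0)
                                :- :- # 1 :* :- # 1 :* (# 3 :+ :- # 1) :- # 4)) refl)
    (trans (cong -_ Δ≡0) -0#≈0#))

  Δ≡0-nonsquare-square : ∀ {x} → Δ x (- fromℕ 1) (fromℕ 1) ≡ 0# → x ≡ 0# ⊎ x ≡ - fromℕ 4
  Δ≡0-nonsquare-square {x} Δ≡0 =
    map₂ (λ x+4≡0 → x-y≡0⇒x≡y (trans (solve 1 (λ x → x :- :- # 4 := x :+ # 4) refl x) x+4≡0))
    (x*y≡0⇒x≡0⊎y≡0 (x≢0⇒x*y≡0⇒y≡0 2≢0 (trans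
      (solve 1 (λ x → # 2 :* (x :* (x :+ # 4))
                      := (x :+ # 1) :* (x :+ # 1) :* (# 3 :+ # 1) :- x :* x :* (# 3 :+ :- # 1) :- # 4) refl x)
      Δ≡0)))

  Δ≡0-nonsquare-nonsquare : ∀ {x} → Δ x (- fromℕ 1) (- fromℕ 1) ≡ 0# → Square x
  Δ≡0-nonsquare-nonsquare {x} Δ≡0 = x * s , x-y≡0⇒x≡y (combination₂-zero x (x * x)
    (solve 2 (λ x s → (x :* s) :* (x :* s) :- x := x :* (# 2 :* x :- # 1) :+ (x :* x) :* (s :* s :- # 2)) refl x s)
    2x-1≡0 (x≡y⇒x-y≡0 s²≡2))
    where
    s = proj₁ Square[2]
    s²≡2 = proj₂ Square[2]
    2x-1≡0 : fromℕ 2 * x - fromℕ 1 ≡ 0#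
    2x-1≡0 = x≢0⇒x*y≡0⇒y≡0 2≢0 (trans
      (solve 1 (λ x → # 2 :* (# 2 :* x :- # 1)
                      := (x :+ # 1) :* (x :+ # 1) :* (# 3 :+ :- # 1) :- x :* x :* (# 3 :+ :- # 1) :- # 4) refl x)
      Δ≡0)

  x+1#≡0⇒x≡-1 : ∀ {x} → x + 1# ≡ 0# → x ≡ - fromℕ 1
  x+1#≡0⇒x≡-1 {x} x+1≡0 = x-y≡0⇒x≡y
    (trans (solve 1 (λ x → x :- :- # 1 := x :+ # 1) refl x) (trans (sym (x+1#≡x+1 x)) x+1≡0))

  -4+1#≡-3 : - fromℕ 4 + 1# ≡ - fromℕ 3
  -4+1#≡-3 = trans (x+1#≡x+1 _) (solve 0 (:- # 4 :+ # 1 := :- # 3) refl)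

  Δ≡0⇒solution : ∀ x → Δ x (e x) (e (x + 1#)) ≡ 0# → Solution x
  Δ≡0⇒solution x Δ≡0 with η-view x | η-view (x + 1#)
  ... | zero x≡0 _      | _                 = inj₁ x≡0
  ... | square _ x□ _   | zero x+1≡0 _      = ⊥-elim (¬Square[-1] (subst Square (x+1#≡0⇒x≡-1 x+1≡0) x□))
  ... | square x≢0 _ e₀ | square _ _ e₁     = ⊥-elim (x≢0 (Δ≡0-square-square (Δ≡0-cong e₀ e₁ Δ≡0)))
  ... | square _ _ e₀   | nonsquare ¬□ e₁   = ⊥-elim (¬□ (subst Square (sym x+1#≡2) Square[2]))
    where
    x+1#≡2 : x + 1# ≡ fromℕ 2
    x+1#≡2 = trans (x+1#≡x+1 x) (trans (cong (_+ fromℕ 1) (Δ≡0-square-nonsquare (Δ≡0-cong e₀ e₁ Δ≡0)))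
                                       (solve 0 (# 1 :+ # 1 := # 2) refl))
  ... | nonsquare _ e₀  | zero x+1≡0 e₁     =
    ⊥-elim (Δ[-1,-1,0]≢0 (subst (λ y → Δ y (- fromℕ 1) 0# ≡ 0#) (x+1#≡0⇒x≡-1 x+1≡0)
                                (Δ≡0-cong e₀ e₁ Δ≡0)))
  ... | nonsquare ¬□ e₀ | square _ x+1□ e₁  with Δ≡0-nonsquare-square (Δ≡0-cong e₀ e₁ Δ≡0)
  ...   | inj₁ refl = ⊥-elim (¬□ (0# , zeroˡ 0#))
  ...   | inj₂ refl = inj₂ (refl , subst Square -4+1#≡-3 x+1□)
  Δ≡0⇒solution x Δ≡0 | nonsquare ¬□ e₀ | nonsquare _ e₁ =
    ⊥-elim (¬□ (Δ≡0-nonsquare-nonsquare (Δ≡0-cong e₀ e₁ Δ≡0)))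

  solution⇒Δ≡0 : ∀ x → Solution x → Δ x (e x) (e (x + 1#)) ≡ 0#
  solution⇒Δ≡0 _ (inj₁ refl) = Δ≡0-cong (sym η-0) (sym (η-square 0+1≢0 (1# , 1*1≡0+1)))
    (solve 0 ((# 0 :+ # 1) :* (# 0 :+ # 1) :* (# 3 :+ # 1) :- # 0 :* # 0 :* (# 3 :+ # 0) :- # 4 := # 0) refl)
    where
    0+1≢0 : 0# + 1# ≢ 0#
    0+1≢0 1≡0 = 0≢1 (sym (trans (sym (+-identityˡ 1#)) 1≡0))
    1*1≡0+1 : 1# * 1# ≡ 0# + 1#
    1*1≡0+1 = trans (*-identityˡ 1#) (sym (+-identityˡ 1#))
  solution⇒Δ≡0 _ (inj₂ (refl , □-3)) =
    Δ≡0-cong (sym (η-nonsquare ¬□-4)) (sym (η-square -4+1#≢0 (subst Square (sym -4+1#≡-3) □-3)))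
    (solve 0 ((:- # 4 :+ # 1) :* (:- # 4 :+ # 1) :* (# 3 :+ # 1) :- :- # 4 :* :- # 4 :* (# 3 :+ :- # 1) :- # 4 := # 0) refl)
    where
    -4+1#≢0 : - fromℕ 4 + 1# ≢ 0#
    -4+1#≢0 -3≡0 = 3≢0 q≢0[3] (-x≡0⇒x≡0 (trans (sym -4+1#≡-3) -3≡0))
    ¬□-4 : ¬ Square (- fromℕ 4)
    ¬□-4 (z , z²≡-4) = ¬Square[-1] (z * h , x-y≡0⇒x≡y
      (combination₂-zero (h * h) (- (fromℕ 2 * h + fromℕ 1))
        (solve 2 (λ z h → (z :* h) :* (z :* h) :- :- # 1
                          := (h :* h) :* (z :* z :- :- # 4) :+ :- (# 2 :* h :+ # 1) :* (# 2 :* h :- # 1)) refl z h)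
        (x≡y⇒x-y≡0 z²≡-4) (x≡y⇒x-y≡0 (x*x⁻¹≡1 2≢0))))
      where h = fromℕ 2 ⁻¹

  solution⇔ : ∀ x → F₂,⅓ (x + 1#) - F₂,⅓ x ≡ b ⇔ Solution x
  solution⇔ x = mk⇔ (λ diff≡b → Δ≡0⇒solution x (Equivalence.to (difference≡b⇔Δ≡0 x) diff≡b))
                    (λ sol → Equivalence.from (difference≡b⇔Δ≡0 x) (solution⇒Δ≡0 x sol))

  δ≡2 : Square (- fromℕ 3) → δ F₂,⅓ 1# b ≡ 2
  δ≡2 □-3 = δ≡length ((0≢-4 ∷ []) ∷ [] ∷ []) (λ {x} → mk⇔
    (λ diff≡b → solution⇒∈ (Equivalence.to (solution⇔ x) diff≡b))
    (λ x∈ → Equivalence.from (solution⇔ x) (∈⇒solution x∈)))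
    where
    0≢-4 : 0# ≢ - fromℕ 4
    0≢-4 0≡-4 = x≢0∧y≢0⇒x*y≢0 2≢0 2≢0
      (trans (solve 0 (# 2 :* # 2 := # 4) refl) (-x≡0⇒x≡0 (sym 0≡-4)))
    solution⇒∈ : ∀ {x} → Solution x → x ∈ 0# ∷ - fromℕ 4 ∷ []
    solution⇒∈ (inj₁ x≡0)        = here x≡0
    solution⇒∈ (inj₂ (x≡-4 , _)) = there (here x≡-4)
    ∈⇒solution : ∀ {x} → x ∈ 0# ∷ - fromℕ 4 ∷ [] → Solution x
    ∈⇒solution (here x≡0)         = inj₁ x≡0
    ∈⇒solution (there (here x≡-4)) = inj₂ (x≡-4 , □-3)

  δ≡1 : ¬ Square (- fromℕ 3) → δ F₂,⅓ 1# b ≡ 1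
  δ≡1 ¬□-3 = δ≡length ([] ∷ []) (λ {x} → mk⇔
    (λ diff≡b → solution⇒∈ (Equivalence.to (solution⇔ x) diff≡b))
    (λ { (here x≡0) → Equivalence.from (solution⇔ x) (inj₁ x≡0) }))
    where
    solution⇒∈ : ∀ {x} → Solution x → x ∈ 0# ∷ []
    solution⇒∈ (inj₁ x≡0)        = here x≡0
    solution⇒∈ (inj₂ (_ , □-3)) = ⊥-elim (¬□-3 □-3)

lemma19 : (q : ℕ) → IsOddPrimePower q → q % 8 ≡ 7 → (K : FiniteField q) →
    let open FiniteField K in
    (q % 24 ≡ 7 → δ F₂,⅓ 1# (fromℕ 4 * (fromℕ 3 ⁻¹)) ≡ 2) ×
    (q % 24 ≡ 23 → δ F₂,⅓ 1# (fromℕ 4 * (fromℕ 3 ⁻¹)) ≡ 1)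
lemma19 q _ q≡7[8] K =
  (λ q≡7[24] → let q≡1[3] = q≡r[24]⇒q≡r[3] q≡7[24] in
     Solutions.δ≡2 K q≡7[8] (q≢0[3] q≡1[3]) (Square[-3] q≡1[3])) ,
  (λ q≡23[24] → let q≡2[3] = q≡r[24]⇒q≡r[3] q≡23[24] in
     Solutions.δ≡1 K q≡7[8] (q≢0[3] q≡2[3]) (¬Square[-3] q≡2[3]))
  where
  open SquareClasses K q≡7[8]
  q≡r[24]⇒q≡r[3] : ∀ {r} → q % 24 ≡ r → q % 3 ≡ r % 3
  q≡r[24]⇒q≡r[3] q≡r = trans (sym (m∣n⇒o%n%m≡o%m 3 24 q (divides 8 refl))) (cong (_% 3) q≡r)
  q≢0[3] : ∀ {r} → q % 3 ≡ suc r → q % 3 ≢ 0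
  q≢0[3] q≡r q≡0 = ℕP.1+n≢0 (trans (sym q≡r) q≡0)
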